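{- For every nonempty partition $\mu$, \[ \mu^{rc}_i=\begin{cases}\mu^c_i+1 & \text{if } i\le d(\mu^{rc}),\\ \mu^c_{i+1} & \text{if } i>d(\mu^{rc}).\end{cases} \]
   Context: For a partition $\lambda$ set $\lambda_t=0$ for $t>\ell(\lambda)$; $d(\lambda)$ is the largest $i\ge1$ with $\lambda_i\ge i$ (length of the diagonal; $d(\emptyset)=0$). The Maya diagram of $\lambda$ is $S(\lambda)=\{\lambda_t-t+\tfrac12:t\ge1\}$. For $S\subseteq\mathbb{Z}+\tfrac12$ let $S^+=\{x\in S:x>0\}$, $S^-=\{x\in(\mathbb{Z}+\tfrac12)\setminus S:x<0\}$; if finite, $c(S)=|S^+|-|S^-|$ and $\{s-c(S):s\in S\}$ is the Maya diagram of a unique partition, the partition associated to $S$. For nonempty $\mu$ with $S=S(\mu)$: $\mu^c$ is the partition associated to $S\cup\{\max S^-\}$, and $\mu^{rc}$ the partition associated to $(S\setminus\{\min S^+\})\cup\{\max S^-\}$. -}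

module Defs where

open import Data.Nat using (ℕ; zero; suc; _≤_; _<_; _≤ᵇ_; _⊔_)
open import Data.Integer as ℤ using (ℤ; +_; _-_; _+_)
open import Data.List using (List; []; _∷_; length)
open import Data.List.Membership.Propositional using (_∈_)
open import Data.List.Relation.Unary.Unique.Propositional using (Unique)
open import Data.Product using (Σ; ∃; _×_; _,_)
open import Data.Sum using (_⊎_)
open import Data.Bool using (if_then_else_)
open import Function.Bundles using (_⇔_)
open import Relation.Nullary using (¬_)
open import Relation.Binary.PropositionalEquality using (_≡_; _≢_)

data Decreasing : List ℕ → Set where
  dec-[]  : Decreasing []
  dec-one : ∀ {x} → Decreasing (x ∷ [])
  dec-∷   : ∀ {x y ys} → y ≤ x → Decreasing (y ∷ ys) → Decreasing (x ∷ y ∷ ys)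

data AllPos : List ℕ → Set where
  pos-[] : AllPos []
  pos-∷  : ∀ {x xs} → 1 ≤ x → AllPos xs → AllPos (x ∷ xs)

IsPartition : List ℕ → Set
IsPartition λ′ = Decreasing λ′ × AllPos λ′

-- 1-indexed parts, with λ_t = 0 for t > ℓ(λ) (and, by convention, index 0 gives 0)
part : List ℕ → ℕ → ℕ
part _        zero          = 0
part []       (suc _)       = 0
part (x ∷ _)  (suc zero)    = x
part (_ ∷ xs) (suc (suc n)) = part xs (suc n)

-- d(λ): largest i ≥ 1 with λ_i ≥ i, or 0 if there is none.
-- (Any such i satisfies i ≤ ℓ(λ), so it suffices to scan the list.)
dgo : List ℕ → ℕ → ℕ
dgo []       i = 0
dgo (x ∷ xs) i = (if i ≤ᵇ x then i else 0) ⊔ dgo xs (suc i)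

d : List ℕ → ℕ
d λ′ = dgo λ′ 1

-- Half-integers k + 1/2 are encoded by the integer k.
-- Subsets of ℤ + 1/2 are predicates on ℤ.
HSet : Set₁
HSet = ℤ → Set

-- Maya diagram S(λ) = { λ_t - t + 1/2 : t ≥ 1 }  (encoded: { λ_t - t })
Maya : List ℕ → HSet
Maya λ′ x = Σ ℕ λ t → (1 ≤ t) × (x ≡ + part λ′ t - + t)

-- S⁺ = {x ∈ S : x > 0}  (k + 1/2 > 0  ⇔  k ≥ 0)
Plus : HSet → HSet
Plus S x = S x × (+ 0 ℤ.≤ x)

-- S⁻ = {x ∉ S : x < 0}  (k + 1/2 < 0  ⇔  k < 0)
Minus : HSet → HSet
Minus S x = (¬ S x) × (x ℤ.< + 0)

HasCard : HSet → ℕ → Set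
HasCard P n = Σ (List ℤ) λ xs → Unique xs × (∀ x → (x ∈ xs) ⇔ P x) × (length xs ≡ n)

Charge : HSet → ℤ → Set
Charge S c = Σ ℕ λ p → Σ ℕ λ q → HasCard (Plus S) p × HasCard (Minus S) q × (c ≡ + p - + q)

AssocPartition : HSet → List ℕ → Set
AssocPartition S ν = IsPartition ν × Σ ℤ λ c → Charge S c × (∀ x → Maya ν x ⇔ S (x + c))

IsMax : HSet → ℤ → Set
IsMax P m = P m × (∀ x → P x → x ℤ.≤ m)

IsMin : HSet → ℤ → Set
IsMin P m = P m × (∀ x → P x → m ℤ.≤ x)

IsC : List ℕ → List ℕ → Set
IsC μ ν = Σ ℤ λ m → IsMax (Minus (Maya μ)) m ×
  AssocPartition (λ x → Maya μ x ⊎ x ≡ m) ν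

IsRC : List ℕ → List ℕ → Set
IsRC μ ρ = Σ ℤ λ m → Σ ℤ λ n → IsMax (Minus (Maya μ)) m × IsMin (Plus (Maya μ)) n ×
  AssocPartition (λ x → (Maya μ x × x ≢ n) ⊎ x ≡ m) ρ

-- Encode the Maya diagram S(λ) as the strictly decreasing sequence t ↦ λ_{t+1} - (t+1),
-- which equals -(t+1) from ℓ(λ) on.  A partition is determined by its sequence, because
-- a strictly decreasing sequence is determined by its image.  If m = max S⁻ sits at
-- position j of the sequence f of μ and n = min S⁺ = f(k) (so k < j),
-- then S ∪ {m} is the image of g = f with m inserted at j, and (S ∖ {n}) ∪ {m} is the
-- image of g with position k removed.  Comparing the tails with those of a Maya
-- diagram gives the charges 1 and 0, hence μ^c_t - t = g(t-1) - 1 and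
-- μ^{rc}_t - t = g(t-1) for t ≤ k and g(t) for t > k.  Exactly the first k entries of
-- that last sequence are nonnegative, so d(μ^{rc}) = k, and the two cases of the
-- theorem are the two halves of this description.
module Submission where

open import Defs
open import Data.Bool using (true; false; T)
open import Data.Empty using (⊥-elim)
open import Data.Integer as ℤ using (ℤ; +_; -[1+_]; _-_; ∣_∣)
import Data.Integer.Properties as ℤP
open import Data.Integer.Tactic.RingSolver using (solve-∀)
open import Data.List using (List; []; _∷_; length)
open import Data.Nat using (ℕ; zero; suc; _+_; _≤_; _<_; z≤n; s≤s; _⊔_; _≤ᵇ_)
open import Data.Nat.Induction using (<-rec)
import Data.Nat.Properties as ℕP
open import Data.Product using (∃; _×_; _,_; proj₁; proj₂)
open import Data.Sum using (_⊎_; inj₁; inj₂)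
open import Data.Sum.Function.Propositional using (_⊎-⇔_)
open import Data.Unit using (tt)
open import Function using (_∘_)
open import Function.Bundles using (_⇔_; mk⇔; Equivalence)
import Function.Properties.Equivalence as ⇔
open import Relation.Binary.Definitions using (tri<; tri≈; tri>)
open import Relation.Binary.PropositionalEquality
  using (_≡_; _≢_; refl; sym; trans; cong; subst; module ≡-Reasoning)
open import Relation.Nullary using (yes; no)

Seq : Set
Seq = ℕ → ℤ

StrictlyDecreasing : Seq → Set
StrictlyDecreasing h = ∀ t → h (suc t) ℤ.< h t

Image : Seq → HSet
Image h x = ∃ λ t → x ≡ h t

module _ (h : Seq) (h↓ : StrictlyDecreasing h) where

  sd-< : ∀ {t s} → t < s → h s ℤ.< h t
  sd-< {t} {suc s} t<1+s with ℕP.m≤n⇒m<n∨m≡n (ℕP.≤-pred t<1+s)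
  ... | inj₁ t<s  = ℤP.<-trans (h↓ s) (sd-< t<s)
  ... | inj₂ refl = h↓ s

  sd-≤ : ∀ {t s} → t ≤ s → h s ℤ.≤ h t
  sd-≤ t≤s with ℕP.m≤n⇒m<n∨m≡n t≤s
  ... | inj₁ t<s  = ℤP.<⇒≤ (sd-< t<s)
  ... | inj₂ refl = ℤP.≤-refl

  sd-injective : ∀ {t s} → h t ≡ h s → t ≡ s
  sd-injective {t} {s} ht≡hs with ℕP.<-cmp t s
  ... | tri< t<s _ _ = ⊥-elim (ℤP.<-irrefl (sym ht≡hs) (sd-< t<s))
  ... | tri≈ _ t≡s _ = t≡s
  ... | tri> _ _ s<t = ⊥-elim (ℤP.<-irrefl ht≡hs (sd-< s<t))

  first-below : ∀ {m} B → h B ℤ.< m → ∃ λ j → h j ℤ.< m × (∀ t → t < j → m ℤ.≤ h t)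
  first-below zero    h0<m = zero , h0<m , λ _ ()
  first-below (suc B) h[1+B]<m with h B ℤ.<? _
  ... | yes hB<m = first-below B hB<m
  ... | no  hB≮m = suc B , h[1+B]<m , λ t t≤B → ℤP.≤-trans (ℤP.≮⇒≥ hB≮m) (sd-≤ (ℕP.≤-pred t≤B))

agree-below⇒≤ : ∀ g h → StrictlyDecreasing g → StrictlyDecreasing h → ∀ t →
  (∀ {u} → u < t → g u ≡ h u) → Image h (g t) → g t ℤ.≤ h t
agree-below⇒≤ g h g↓ h↓ t agree (s , gt≡hs) with ℕP.<-cmp s t
... | tri< s<t _ _ = ⊥-elim (ℤP.<-irrefl (trans gt≡hs (sym (agree s<t))) (sd-< g g↓ s<t))
... | tri≈ _ refl _ = ℤP.≤-reflexive gt≡hs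
... | tri> _ _ t<s = ℤP.≤-trans (ℤP.≤-reflexive gt≡hs) (sd-≤ h h↓ (ℕP.<⇒≤ t<s))

sd-image-unique : ∀ g h → StrictlyDecreasing g → StrictlyDecreasing h →
  (∀ x → Image g x ⇔ Image h x) → ∀ t → g t ≡ h t
sd-image-unique g h g↓ h↓ g≅h = <-rec _ λ t agree →
  ℤP.≤-antisym
    (agree-below⇒≤ g h g↓ h↓ t agree (Equivalence.to (g≅h _) (t , refl)))
    (agree-below⇒≤ h g h↓ g↓ t (λ u<t → sym (agree u<t)) (Equivalence.from (g≅h _) (t , refl)))

removeAt : Seq → ℕ → Seq
removeAt h zero    t       = h (suc t)
removeAt h (suc k) zero    = h zero
removeAt h (suc k) (suc t) = removeAt (h ∘ suc) k t

removeAt-< : ∀ h k t → t < k → removeAt h k t ≡ h t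
removeAt-< h (suc k) zero    _         = refl
removeAt-< h (suc k) (suc t) (s≤s t<k) = removeAt-< (h ∘ suc) k t t<k

removeAt-≥ : ∀ h k t → k ≤ t → removeAt h k t ≡ h (suc t)
removeAt-≥ h zero    t       _         = refl
removeAt-≥ h (suc k) (suc t) (s≤s k≤t) = removeAt-≥ (h ∘ suc) k t k≤t

removeAt-skips : ∀ h k t → ∃ λ s → s ≢ k × removeAt h k t ≡ h s
removeAt-skips h zero    t       = suc t , (λ ()) , refl
removeAt-skips h (suc k) zero    = zero , (λ ()) , refl
removeAt-skips h (suc k) (suc t) with removeAt-skips (h ∘ suc) k t
... | s , s≢k , e = suc s , (λ 1+s≡1+k → s≢k (ℕP.suc-injective 1+s≡1+k)) , e

removeAt-hits : ∀ h k s → s ≢ k → ∃ λ t → removeAt h k t ≡ h s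
removeAt-hits h zero    zero    s≢k = ⊥-elim (s≢k refl)
removeAt-hits h zero    (suc s) _   = s , refl
removeAt-hits h (suc k) zero    _   = zero , refl
removeAt-hits h (suc k) (suc s) s≢k with removeAt-hits (h ∘ suc) k s (s≢k ∘ cong suc)
... | t , e = suc t , e

removeAt-sd : ∀ h k → StrictlyDecreasing h → StrictlyDecreasing (removeAt h k)
removeAt-sd h zero    h↓ t       = h↓ (suc t)
removeAt-sd h (suc k) h↓ zero    with removeAt-skips (h ∘ suc) k zero
... | s , _ , e = subst (ℤ._< h zero) (sym e) (sd-< h h↓ (s≤s z≤n))
removeAt-sd h (suc k) h↓ (suc t) = removeAt-sd (h ∘ suc) k (h↓ ∘ suc) t

removeAt-image : ∀ h k → StrictlyDecreasing h → ∀ x → Image (removeAt h k) x ⇔ (Image h x × x ≢ h k)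
removeAt-image h k h↓ x = mk⇔ to from
  where
  to : Image (removeAt h k) x → Image h x × x ≢ h k
  to (t , x≡) with removeAt-skips h k t
  ... | s , s≢k , e = (s , trans x≡ e) , λ x≡hk → s≢k (sd-injective h h↓ (trans (sym (trans x≡ e)) x≡hk))
  from : Image h x × x ≢ h k → Image (removeAt h k) x
  from ((s , x≡hs) , x≢hk) with removeAt-hits h k s (λ s≡k → x≢hk (trans x≡hs (cong h s≡k)))
  ... | t , e = t , trans x≡hs (sym e)

insertAt : Seq → ℕ → ℤ → Seq
insertAt h zero    m zero    = m
insertAt h zero    m (suc t) = h t
insertAt h (suc j) m zero    = h zero
insertAt h (suc j) m (suc t) = insertAt (h ∘ suc) j m t

insertAt-< : ∀ h j m t → t < j → insertAt h j m t ≡ h t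
insertAt-< h (suc j) m zero    _         = refl
insertAt-< h (suc j) m (suc t) (s≤s t<j) = insertAt-< (h ∘ suc) j m t t<j

insertAt-> : ∀ h j m t → j ≤ t → insertAt h j m (suc t) ≡ h t
insertAt-> h zero    m t       _         = refl
insertAt-> h (suc j) m (suc t) (s≤s j≤t) = insertAt-> (h ∘ suc) j m t j≤t

insertAt-sd : ∀ h j m → StrictlyDecreasing h → (∀ t → t < j → m ℤ.< h t) → h j ℤ.< m →
  StrictlyDecreasing (insertAt h j m)
insertAt-sd h zero          m h↓ _     hj<m zero    = hj<m
insertAt-sd h zero          m h↓ _     _    (suc t) = h↓ t
insertAt-sd h (suc zero)    m h↓ m<h   _    zero    = m<h zero (s≤s z≤n)
insertAt-sd h (suc (suc j)) m h↓ _     _    zero    = h↓ zero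
insertAt-sd h (suc j)       m h↓ m<h   hj<m (suc t) =
  insertAt-sd (h ∘ suc) j m (h↓ ∘ suc) (λ t t<j → m<h (suc t) (s≤s t<j)) hj<m t

insertAt-image : ∀ h j m x → Image (insertAt h j m) x ⇔ (Image h x ⊎ x ≡ m)
insertAt-image h j m x = mk⇔ (to h j) (from h j)
  where
  to : ∀ h j → Image (insertAt h j m) x → Image h x ⊎ x ≡ m
  to h zero    (zero  , x≡) = inj₂ x≡
  to h zero    (suc t , x≡) = inj₁ (t , x≡)
  to h (suc j) (zero  , x≡) = inj₁ (zero , x≡)
  to h (suc j) (suc t , x≡) with to (h ∘ suc) j (t , x≡)
  ... | inj₁ (s , x≡h[1+s]) = inj₁ (suc s , x≡h[1+s])
  ... | inj₂ x≡m            = inj₂ x≡m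
  from : ∀ h j → Image h x ⊎ x ≡ m → Image (insertAt h j m) x
  from h zero    (inj₁ (s , x≡)) = suc s , x≡
  from h zero    (inj₂ x≡m)      = zero , x≡m
  from h (suc j) (inj₁ (zero  , x≡)) = zero , x≡
  from h (suc j) (inj₁ (suc s , x≡)) with from (h ∘ suc) j (inj₁ (s , x≡))
  ... | t , x≡′ = suc t , x≡′
  from h (suc j) (inj₂ x≡m) with from (h ∘ suc) j (inj₂ x≡m)
  ... | t , x≡′ = suc t , x≡′

maya : List ℕ → Seq
maya l t = + part l (suc t) - + suc t

Maya⇔Image : ∀ l x → Maya l x ⇔ Image (maya l) x
Maya⇔Image l x = mk⇔ (λ { (zero , () , _) ; (suc t , _ , x≡) → t , x≡ })
                     (λ (t , x≡) → suc t , s≤s z≤n , x≡)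

part-antitone : ∀ {l} → Decreasing l → ∀ t → part l (suc (suc t)) ≤ part l (suc t)
part-antitone dec-[]          t       = z≤n
part-antitone dec-one         t       = z≤n
part-antitone (dec-∷ y≤x _)   zero    = y≤x
part-antitone (dec-∷ _ rest↓) (suc t) = part-antitone rest↓ t

maya↓ : ∀ {l} → Decreasing l → StrictlyDecreasing (maya l)
maya↓ {l} l↓ t = ℤP.≤-<-trans
  (ℤP.+-monoˡ-≤ (ℤ.- + suc (suc t)) (ℤ.+≤+ (part-antitone l↓ t)))
  (ℤP.+-monoʳ-< (+ part l (suc t)) (ℤP.neg-mono-< (ℤ.+<+ (ℕP.n<1+n (suc t)))))

part-beyond : ∀ l t → length l ≤ t → part l (suc t) ≡ 0
part-beyond []      t       _         = refl
part-beyond (_ ∷ l) (suc t) (s≤s ℓ≤t) = part-beyond l t ℓ≤t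

maya-beyond : ∀ l t → length l ≤ t → maya l t ≡ -[1+ t ]
maya-beyond l t ℓ≤t = cong (λ p → + p - + suc t) (part-beyond l t ℓ≤t)

0≤maya⇒t<part : ∀ l t → + 0 ℤ.≤ maya l t → t < part l (suc t)
0≤maya⇒t<part l t 0≤maya = ℤP.drop‿+≤+ (ℤP.0≤i-j⇒j≤i 0≤maya)

maya<0⇒part≤t : ∀ l t → maya l t ℤ.< + 0 → part l (suc t) ≤ t
maya<0⇒part≤t l t maya<0 = ℕP.≤-pred (ℕP.≰⇒> λ t<part →
  ℤP.<⇒≱ maya<0 (ℤP.i≤j⇒0≤j-i (ℤ.+≤+ t<part)))

dgo-none : ∀ xs i → (∀ t → part xs (suc t) < i + t) → dgo xs i ≡ 0
dgo-none []       i _     = refl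
dgo-none (x ∷ xs) i below with i ≤ᵇ x in i≤ᵇx
... | true  = ⊥-elim (ℕP.<⇒≱ (subst (x <_) (ℕP.+-identityʳ i) (below 0))
                             (ℕP.≤ᵇ⇒≤ i x (subst T (sym i≤ᵇx) tt)))
... | false = dgo-none xs (suc i) λ t → subst (part xs (suc t) <_) (ℕP.+-suc i t) (below (suc t))

dgo-last : ∀ xs i K → 1 ≤ i → (∀ t → t ≤ K → i + t ≤ part xs (suc t)) →
  (∀ t → K < t → part xs (suc t) < i + t) → dgo xs i ≡ i + K
dgo-last []       i K 1≤i above _ =
  ⊥-elim (ℕP.<-irrefl refl (ℕP.<-≤-trans 1≤i (ℕP.≤-trans (ℕP.m≤m+n i 0) (above 0 z≤n))))
dgo-last (x ∷ xs) i K 1≤i above below with i ≤ᵇ x in i≤ᵇx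
... | false = ⊥-elim (subst T i≤ᵇx (ℕP.≤⇒≤ᵇ (ℕP.≤-trans (ℕP.m≤m+n i 0) (above 0 z≤n))))
... | true with K
...   | zero = begin
  i ⊔ dgo xs (suc i) ≡⟨ cong (i ⊔_) (dgo-none xs (suc i) λ t →
                          subst (part xs (suc t) <_) (ℕP.+-suc i t) (below (suc t) (s≤s z≤n))) ⟩
  i ⊔ 0              ≡⟨ ℕP.⊔-identityʳ i ⟩
  i                  ≡⟨ ℕP.+-identityʳ i ⟨
  i + 0              ∎
  where open ≡-Reasoning
...   | suc K′ = begin
  i ⊔ dgo xs (suc i) ≡⟨ cong (i ⊔_) (dgo-last xs (suc i) K′ (s≤s z≤n)
                          (λ t t≤K′ → subst (_≤ part xs (suc t)) (ℕP.+-suc i t) (above (suc t) (s≤s t≤K′)))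
                          (λ t K′<t → subst (part xs (suc t) <_) (ℕP.+-suc i t) (below (suc t) (s≤s K′<t)))) ⟩
  i ⊔ (suc i + K′)   ≡⟨ ℕP.m≤n⇒m⊔n≡n (ℕP.≤-trans (ℕP.n≤1+n i) (ℕP.m≤m+n (suc i) K′)) ⟩
  suc i + K′         ≡⟨ ℕP.+-suc i K′ ⟨
  i + suc K′         ∎
  where open ≡-Reasoning

d-from-maya : ∀ l K → (∀ t → t < K → + 0 ℤ.≤ maya l t) → (∀ t → K ≤ t → maya l t ℤ.< + 0) → d l ≡ K
d-from-maya l zero    _      negative = dgo-none l 1 λ t → s≤s (maya<0⇒part≤t l t (negative t z≤n))
d-from-maya l (suc K) nonneg negative = dgo-last l 1 K (s≤s z≤n)
  (λ t t≤K → 0≤maya⇒t<part l t (nonneg t (s≤s t≤K)))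
  (λ t K<t → s≤s (maya<0⇒part≤t l t (negative t K<t)))

x-c+c≡x : ∀ x c → (x - c) ℤ.+ c ≡ x
x-c+c≡x = solve-∀

Image-shift : ∀ h c x → Image h (x ℤ.+ c) ⇔ Image (λ t → h t - c) x
Image-shift h c x = mk⇔ (λ (t , x+c≡) → t , trans (x≡x+c-c x c) (cong (_- c) x+c≡))
                        (λ (t , x≡) → t , trans (cong (ℤ._+ c) x≡) (x-c+c≡x (h t) c))
  where
  x≡x+c-c : ∀ x c → x ≡ (x ℤ.+ c) - c
  x≡x+c-c = solve-∀

maya-charged : ∀ {T : HSet} {ν} → Decreasing ν → (c : ℤ) → (∀ x → Maya ν x ⇔ T (x ℤ.+ c)) →
  (h : Seq) → StrictlyDecreasing h → (∀ x → T x ⇔ Image h x) → ∀ t → maya ν t ≡ h t - c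
maya-charged {ν = ν} ν↓ c ν≅T h h↓ T≅h = sd-image-unique (maya ν) (λ t → h t - c) (maya↓ ν↓)
  (λ t → ℤP.+-monoˡ-< (ℤ.- c) (h↓ t))
  (λ x → ⇔.trans (⇔.sym (Maya⇔Image ν x)) (⇔.trans (ν≅T x) (⇔.trans (T≅h _) (Image-shift h c x))))

-- Past ℓ(ν) the Maya sequence is -(t+1), so comparing tails fixes the charge without counting S⁺ and S⁻.
charge-from-tail : ∀ ν (h : Seq) c k N → (∀ t → maya ν t ≡ h t - c) →
  (∀ t → N ≤ t → h t ≡ -[1+ t ] ℤ.+ k) → c ≡ k
charge-from-tail ν h c k N maya≡ tail = begin
  c                 ≡⟨ c≡y-[y-c] (x ℤ.+ k) c ⟩
  (x ℤ.+ k) - ((x ℤ.+ k) - c) ≡⟨ cong (λ y → (x ℤ.+ k) - (y - c)) (tail t (ℕP.m≤m+n N _)) ⟨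
  (x ℤ.+ k) - (h t - c)       ≡⟨ cong ((x ℤ.+ k) -_) (trans (sym (maya≡ t)) (maya-beyond ν t (ℕP.m≤n+m _ N))) ⟩
  (x ℤ.+ k) - x     ≡⟨ x+k-x≡k x k ⟩
  k                 ∎
  where
  open ≡-Reasoning
  t : ℕ
  t = N + length ν
  x : ℤ
  x = -[1+ t ]
  c≡y-[y-c] : ∀ y c → c ≡ y - (y - c)
  c≡y-[y-c] = solve-∀
  x+k-x≡k : ∀ x k → (x ℤ.+ k) - x ≡ k
  x+k-x≡k = solve-∀

maya-associated : ∀ {T : HSet} {ν} → Decreasing ν → (c : ℤ) → (∀ x → Maya ν x ⇔ T (x ℤ.+ c)) →
  (h : Seq) → StrictlyDecreasing h → (∀ x → T x ⇔ Image h x) →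
  (k : ℤ) (N : ℕ) → (∀ t → N ≤ t → h t ≡ -[1+ t ] ℤ.+ k) → ∀ t → maya ν t ℤ.+ k ≡ h t
maya-associated {ν = ν} ν↓ c ν≅T h h↓ T≅h k N tail t = begin
  maya ν t ℤ.+ k     ≡⟨ cong (λ c → maya ν t ℤ.+ c) c≡k ⟨
  maya ν t ℤ.+ c     ≡⟨ cong (ℤ._+ c) (maya≡ t) ⟩
  (h t - c) ℤ.+ c    ≡⟨ x-c+c≡x (h t) c ⟩
  h t                ∎
  where
  open ≡-Reasoning
  maya≡ = maya-charged ν↓ c ν≅T h h↓ T≅h
  c≡k = charge-from-tail ν h c k N maya≡ tail

part-from-maya : ∀ l t → + part l (suc t) ≡ maya l t ℤ.+ + suc t
part-from-maya l t = sym (x-c+c≡x (+ part l (suc t)) (+ suc t))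

part-from-maya-step : ∀ ρ ν t → maya ρ t ≡ maya ν t ℤ.+ + 1 → part ρ (suc t) ≡ part ν (suc t) + 1
part-from-maya-step ρ ν t maya≡ = ℤP.+-injective (begin
  + part ρ (suc t)                    ≡⟨ part-from-maya ρ t ⟩
  maya ρ t ℤ.+ + suc t                ≡⟨ cong (ℤ._+ + suc t) maya≡ ⟩
  (maya ν t ℤ.+ + 1) ℤ.+ + suc t      ≡⟨ ℤP.+-assoc (maya ν t) (+ 1) (+ suc t) ⟩
  maya ν t ℤ.+ (+ 1 ℤ.+ + suc t)      ≡⟨ cong (λ y → maya ν t ℤ.+ y) (ℤP.+-comm (+ 1) (+ suc t)) ⟩
  maya ν t ℤ.+ (+ suc t ℤ.+ + 1)      ≡⟨ ℤP.+-assoc (maya ν t) (+ suc t) (+ 1) ⟨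
  (maya ν t ℤ.+ + suc t) ℤ.+ + 1      ≡⟨ cong (ℤ._+ + 1) (part-from-maya ν t) ⟨
  + part ν (suc t) ℤ.+ + 1            ∎)
  where open ≡-Reasoning

part-from-maya-shift : ∀ ρ ν t → maya ρ t ≡ maya ν (suc t) ℤ.+ + 1 → part ρ (suc t) ≡ part ν (suc (suc t))
part-from-maya-shift ρ ν t maya≡ = ℤP.+-injective (begin
  + part ρ (suc t)                    ≡⟨ part-from-maya ρ t ⟩
  maya ρ t ℤ.+ + suc t                ≡⟨ cong (ℤ._+ + suc t) maya≡ ⟩
  (maya ν (suc t) ℤ.+ + 1) ℤ.+ + suc t ≡⟨ ℤP.+-assoc (maya ν (suc t)) (+ 1) (+ suc t) ⟩
  maya ν (suc t) ℤ.+ + suc (suc t)    ≡⟨ part-from-maya ν (suc t) ⟨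
  + part ν (suc (suc t))              ∎)
  where open ≡-Reasoning

-[1+∣i∣+n]<i : ∀ i n → -[1+ ∣ i ∣ + n ] ℤ.< i
-[1+∣i∣+n]<i (+ _)    n = ℤ.-<+
-[1+∣i∣+n]<i -[1+ k ] n = ℤ.-<- (s≤s (ℕP.m≤m+n k n))

isMax-unique : ∀ {P : HSet} {a b} → IsMax P a → IsMax P b → a ≡ b
isMax-unique (a∈P , a-max) (b∈P , b-max) = ℤP.≤-antisym (b-max _ a∈P) (a-max _ b∈P)

module MayaMoves (μ : List ℕ) (μ↓ : Decreasing μ)
             (m : ℤ) (m∈S⁻ : Minus (Maya μ) m)
             (n : ℤ) (n-min : IsMin (Plus (Maya μ)) n) where

  f : Seq
  f = maya μ

  f↓ : StrictlyDecreasing f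
  f↓ = maya↓ μ↓

  k : ℕ
  k = proj₁ (Equivalence.to (Maya⇔Image μ n) (proj₁ (proj₁ n-min)))

  n≡fk : n ≡ f k
  n≡fk = proj₂ (Equivalence.to (Maya⇔Image μ n) (proj₁ (proj₁ n-min)))

  private
    position-of-m : ∃ λ j → f j ℤ.< m × (∀ t → t < j → m ℤ.≤ f t)
    position-of-m = first-below f f↓ (∣ m ∣ + length μ)
      (subst (ℤ._< m) (sym (maya-beyond μ _ (ℕP.m≤n+m _ ∣ m ∣))) (-[1+∣i∣+n]<i m (length μ)))

  j : ℕ
  j = proj₁ position-of-m

  fj<m : f j ℤ.< m
  fj<m = proj₁ (proj₂ position-of-m)

  m<f : ∀ t → t < j → m ℤ.< f t
  m<f t t<j = ℤP.≤∧≢⇒< (proj₂ (proj₂ position-of-m) t t<j)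
    (λ m≡ft → proj₁ m∈S⁻ (Equivalence.from (Maya⇔Image μ m) (t , m≡ft)))

  k<j : k < j
  k<j = ℕP.≰⇒> λ j≤k → ℤP.<-irrefl refl (ℤP.≤-<-trans (sd-≤ f f↓ j≤k) (ℤP.<-trans fj<m
          (ℤP.<-≤-trans (proj₂ m∈S⁻) (subst (+ 0 ℤ.≤_) n≡fk (proj₂ (proj₁ n-min))))))

  hν : Seq
  hν = insertAt f j m

  hν↓ : StrictlyDecreasing hν
  hν↓ = insertAt-sd f j m f↓ m<f fj<m

  hρ : Seq
  hρ = removeAt hν k

  hρ↓ : StrictlyDecreasing hρ
  hρ↓ = removeAt-sd hν k hν↓

  hν-image : ∀ x → (Maya μ x ⊎ x ≡ m) ⇔ Image hν x
  hν-image x = ⇔.trans (Maya⇔Image μ x ⊎-⇔ ⇔.refl) (⇔.sym (insertAt-image f j m x))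

  hν-k : hν k ≡ n
  hν-k = trans (insertAt-< f j m k k<j) (sym n≡fk)

  m≢n : m ≢ n
  m≢n m≡n = ℤP.<⇒≱ (proj₂ m∈S⁻) (subst (+ 0 ℤ.≤_) (sym m≡n) (proj₂ (proj₁ n-min)))

  hρ-image : ∀ x → ((Maya μ x × x ≢ n) ⊎ x ≡ m) ⇔ Image hρ x
  hρ-image x = mk⇔ to from
    where
    removeAt-k = removeAt-image hν k hν↓ x
    to : (Maya μ x × x ≢ n) ⊎ x ≡ m → Image hρ x
    to (inj₁ (x∈S , x≢n)) = Equivalence.from removeAt-k
      (Equivalence.to (hν-image x) (inj₁ x∈S) , λ x≡hνk → x≢n (trans x≡hνk hν-k))
    to (inj₂ refl)        = Equivalence.from removeAt-k
      (Equivalence.to (hν-image x) (inj₂ refl) , λ m≡hνk → m≢n (trans m≡hνk hν-k))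
    from : Image hρ x → (Maya μ x × x ≢ n) ⊎ x ≡ m
    from x∈hρ with Equivalence.to removeAt-k x∈hρ
    ... | x∈hν , x≢hνk with Equivalence.from (hν-image x) x∈hν
    ...   | inj₁ x∈S = inj₁ (x∈S , λ x≡n → x≢hνk (trans x≡n (sym hν-k)))
    ...   | inj₂ x≡m = inj₂ x≡m

  hν-tail : ∀ t → suc (j + length μ) ≤ t → hν t ≡ -[1+ t ] ℤ.+ + 1
  hν-tail (suc t) (s≤s j+ℓ≤t) =
    trans (insertAt-> f j m t (ℕP.m+n≤o⇒m≤o j j+ℓ≤t)) (maya-beyond μ t (ℕP.m+n≤o⇒n≤o j j+ℓ≤t))

  hρ-tail : ∀ t → j + length μ ≤ t → hρ t ≡ -[1+ t ] ℤ.+ + 0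
  hρ-tail t j+ℓ≤t = trans (removeAt-≥ hν k t k≤t)
    (trans (hν-tail (suc t) (s≤s j+ℓ≤t)) (sym (ℤP.+-identityʳ -[1+ t ])))
    where k≤t = ℕP.≤-trans (ℕP.<⇒≤ k<j) (ℕP.m+n≤o⇒m≤o j j+ℓ≤t)

  below-n⇒negative : ∀ x → Maya μ x ⊎ x ≡ m → x ℤ.< n → x ℤ.< + 0
  below-n⇒negative x (inj₁ x∈S) x<n = ℤP.≰⇒> λ 0≤x → ℤP.<⇒≱ x<n (proj₂ n-min x (x∈S , 0≤x))
  below-n⇒negative x (inj₂ refl) _  = proj₂ m∈S⁻

  d≡k : ∀ ρ → (∀ t → maya ρ t ≡ hρ t) → d ρ ≡ k
  d≡k ρ maya≡hρ = d-from-maya ρ k nonneg negative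
    where
    nonneg : ∀ t → t < k → + 0 ℤ.≤ maya ρ t
    nonneg t t<k = subst (+ 0 ℤ.≤_) fk≡mayaρ (ℤP.≤-trans (proj₂ (proj₁ n-min))
                     (subst (ℤ._≤ f t) (sym n≡fk) (sd-≤ f f↓ (ℕP.<⇒≤ t<k))))
      where
      fk≡mayaρ : f t ≡ maya ρ t
      fk≡mayaρ = sym (trans (maya≡hρ t) (trans (removeAt-< hν k t t<k)
                   (insertAt-< f j m t (ℕP.<-trans t<k k<j))))
    hν[1+k]<0 : hν (suc k) ℤ.< + 0
    hν[1+k]<0 = below-n⇒negative _ (Equivalence.from (hν-image _) (suc k , refl))
                  (subst (hν (suc k) ℤ.<_) hν-k (hν↓ k))
    negative : ∀ t → k ≤ t → maya ρ t ℤ.< + 0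
    negative t k≤t = subst (ℤ._< + 0) (sym (maya≡hρ t))
      (ℤP.≤-<-trans (sd-≤ hρ hρ↓ k≤t)
        (subst (ℤ._< + 0) (sym (removeAt-≥ hν k k ℕP.≤-refl)) hν[1+k]<0))

  rc-from-c : ∀ ν ρ → (∀ t → maya ν t ℤ.+ + 1 ≡ hν t) → (∀ t → maya ρ t ℤ.+ + 0 ≡ hρ t) → ∀ t →
    (suc t ≤ d ρ → part ρ (suc t) ≡ part ν (suc t) + 1) ×
    (d ρ < suc t → part ρ (suc t) ≡ part ν (suc (suc t)))
  rc-from-c ν ρ maya-ν maya-ρ t = inside , outside
    where
    maya≡hρ : ∀ t → maya ρ t ≡ hρ t
    maya≡hρ t = trans (sym (ℤP.+-identityʳ (maya ρ t))) (maya-ρ t)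
    inside : suc t ≤ d ρ → part ρ (suc t) ≡ part ν (suc t) + 1
    inside t<dρ = part-from-maya-step ρ ν t
      (trans (maya≡hρ t) (trans (removeAt-< hν k t t<k) (sym (maya-ν t))))
      where t<k = subst (t <_) (d≡k ρ maya≡hρ) t<dρ
    outside : d ρ < suc t → part ρ (suc t) ≡ part ν (suc (suc t))
    outside dρ<1+t = part-from-maya-shift ρ ν t
      (trans (maya≡hρ t) (trans (removeAt-≥ hν k t k≤t) (sym (maya-ν (suc t)))))
      where k≤t = ℕP.≤-pred (subst (_< suc t) (d≡k ρ maya≡hρ) dρ<1+t)

lemma5p33 : (μ : List ℕ) → IsPartition μ → μ ≢ [] →
    (ν ρ : List ℕ) → IsC μ ν → IsRC μ ρ →
    (i : ℕ) → 1 ≤ i →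
      (i ≤ d ρ → part ρ i ≡ part ν i + 1) ×
      (d ρ < i → part ρ i ≡ part ν (suc i))
lemma5p33 μ (μ↓ , _) _ ν ρ (m , m-max@(m∈S⁻ , _) , (ν↓ , _) , c , _ , ν≅)
          (m′ , n , m′-max , n-min , (ρ↓ , _) , c′ , _ , ρ≅) (suc t) _ =
  rc-from-c ν ρ (maya-associated ν↓ c ν≅ hν hν↓ hν-image (+ 1) _ hν-tail)
            (maya-associated ρ↓ c′ ρ≅′ hρ hρ↓ hρ-image (+ 0) _ hρ-tail) t
  where
  open MayaMoves μ μ↓ m m∈S⁻ n n-min
  ρ≅′ : ∀ x → Maya ρ x ⇔ ((Maya μ (x ℤ.+ c′) × x ℤ.+ c′ ≢ n) ⊎ x ℤ.+ c′ ≡ m)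
  ρ≅′ = subst (λ m → ∀ x → Maya ρ x ⇔ ((Maya μ (x ℤ.+ c′) × x ℤ.+ c′ ≢ n) ⊎ x ℤ.+ c′ ≡ m))
              (isMax-unique m′-max m-max) ρ≅
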